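{- Let $A$ be a $\tau$-structure, $C(A)$ its coarsest coherent $\sigma$-configuration, $R\in\sigma$, and $\mathcal{S}$ the set of strongly connected components of $R(C(A))$. Fix $E\in\tau$. Let $V,W\in\mathcal{S}$ and $v',w'\in V(A)$ be such that there is a $v\in V$ with $(v',v)\in E(A)$, and $(w',w)\notin E(A)$ for all $w\in W$. Let $z\in V$ be arbitrary and $T\in\sigma$ with $(v',z)\in T(C(A))$. Then $T(C(A))\cap(\{w'\}\times W)=\emptyset$.
   Context: Structures are finite with only binary relations. A coherent $\sigma$-configuration is a $\sigma$-structure whose relations partition $V^2$, each inside or disjoint from the diagonal, closed under converses, with well-defined intersection numbers (for all $R_1,R_2,R_3\in\sigma$ the number of $w$ with $(u,w)\in R_2$, $(w,v)\in R_3$ is the same for all $(u,v)\in R_1$). $C(A)$ is the coarsest coherent configuration refining $A$ (each of its relations contained in or disjoint from each relation of $A$). Strongly connected components of a relation $R$ are inclusion-maximal sets $S$ such that for all $u,v\in S$ there is an $R$-path of length at least $1$ from $u$ to $v$. -}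

module Defs where

open import Data.Nat using (ℕ; zero; suc)
open import Data.Fin using (Fin)
open import Data.Bool using (Bool; true; false; _∧_)
open import Data.Product using (Σ; ∃; _×_; _,_)
open import Data.Sum using (_⊎_)
open import Relation.Binary.PropositionalEquality using (_≡_)

BinRel : ℕ → Set
BinRel n = Fin n → Fin n → Bool

Structure : ℕ → ℕ → Set
Structure n k = Fin k → BinRel n

VSet : ℕ → Set
VSet n = Fin n → Bool

count : ∀ {n} → (Fin n → Bool) → ℕ
count {zero}  P = 0
count {suc n} P with P Fin.zero
... | true  = suc (count {n} (λ x → P (Fin.suc x)))
... | false = count {n} (λ x → P (Fin.suc x))

record IsCoherent {n s : ℕ} (C : Structure n s) : Set where
  field
    nonempty  : ∀ i → Σ (Fin n) λ u → Σ (Fin n) λ v → C i u v ≡ true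
    cover     : ∀ u v → Σ (Fin s) λ i → C i u v ≡ true
    disjoint  : ∀ i j u v → C i u v ≡ true → C j u v ≡ true → i ≡ j
    diagonal  : ∀ i → (∀ u v → C i u v ≡ true → u ≡ v)
                    ⊎ (∀ u → C i u u ≡ false)
    converse  : ∀ i → Σ (Fin s) λ j → ∀ u v → C j u v ≡ C i v u
    intersect : ∀ i j k u v u' v' → C i u v ≡ true → C i u' v' ≡ true →
                count (λ w → C j u w ∧ C k w v)
                  ≡ count (λ w → C j u' w ∧ C k w v')

Refines : ∀ {n s k} → Structure n s → Structure n k → Set
Refines {n} {s} {k} D A =
  ∀ (i : Fin s) (e : Fin k) →
    (∀ u v → D i u v ≡ true → A e u v ≡ true)
    ⊎ (∀ u v → D i u v ≡ true → A e u v ≡ false)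

-- C is a coarsest coherent configuration refining A (i.e. C is C(A))
record IsCoarsestCoherent {n k s : ℕ} (A : Structure n k) (C : Structure n s) : Set where
  field
    coherent : IsCoherent C
    refines  : Refines C A
    coarsest : ∀ (s' : ℕ) (D : Structure n s') → IsCoherent D → Refines D A → Refines D C

-- R-paths of length at least 1
data Path {n : ℕ} (R : BinRel n) : Fin n → Fin n → Set where
  edge : ∀ {u v} → R u v ≡ true → Path R u v
  step : ∀ {u w v} → R u w ≡ true → Path R w v → Path R u v

StronglyConnected : ∀ {n} → BinRel n → VSet n → Set
StronglyConnected R S = ∀ u v → S u ≡ true → S v ≡ true → Path R u v

_⊆_ : ∀ {n} → VSet n → VSet n → Set
S ⊆ S' = ∀ u → S u ≡ true → S' u ≡ true

IsSCC : ∀ {n} → BinRel n → VSet n → Set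
IsSCC R S = StronglyConnected R S × (∀ S' → S ⊆ S' → StronglyConnected R S' → S' ⊆ S)

{-# OPTIONS --safe #-}
module Submission where

-- Suppose (w', w) ∈ T.  Let U be the basis relation of (v', v) and K that of (v, z).
-- Since (v', z) ∈ T, the intersection number p^T_{UK} is nonzero, so some y has
-- (w', y) ∈ U and (y, w) ∈ K.  Coherence transports the R-paths between v and z
-- along K (and back along its converse), so y and w are R-strongly connected and y ∈ W.
-- But U ⊆ E because U meets E at (v', v), so (w', y) ∈ E, contradicting the choice of w'.

open import Defs
open import Data.Nat using (ℕ; zero; suc)
open import Data.Fin using (Fin; zero; suc; _≟_)
open import Data.Bool using (Bool; true; false; _∧_; _∨_)
open import Data.Bool.Properties using (∨-zeroʳ; ¬-not)
open import Data.Product using (Σ; _×_; _,_; proj₁)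
open import Data.Sum using (_⊎_; inj₁; inj₂)
open import Relation.Nullary using (¬_; yes; no; does)
open import Relation.Nullary.Decidable using (dec-true)
open import Relation.Binary.PropositionalEquality using (_≡_; _≢_; refl; sym; trans)

∧-true : ∀ {a b} → a ∧ b ≡ true → a ≡ true × b ≡ true
∧-true {true} {true} refl = refl , refl

true-∧ : ∀ {a b} → a ≡ true → b ≡ true → a ∧ b ≡ true
true-∧ refl refl = refl

count-true≢0 : ∀ {n} (P : Fin n → Bool) {x} → P x ≡ true → count P ≢ 0
count-true≢0 {suc n} P {x} Px≡true with P zero in P0
... | true = λ ()
count-true≢0 {suc n} P {zero}  Px≡true | false with trans (sym P0) Px≡true
... | ()
count-true≢0 {suc n} P {suc x} Px≡true | false = count-true≢0 (λ y → P (suc y)) Px≡true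

count≢0⇒true : ∀ {n} (P : Fin n → Bool) → count P ≢ 0 → Σ (Fin n) λ x → P x ≡ true
count≢0⇒true {zero}  P count≢0 with () ← count≢0 refl
count≢0⇒true {suc n} P count≢0 with P zero in P0
... | true  = zero , P0
... | false with x , Px ← count≢0⇒true (λ y → P (suc y)) count≢0 = suc x , Px

_++_ : ∀ {n} {R : BinRel n} {a b c} → Path R a b → Path R b c → Path R a c
edge r   ++ q = step r q
step r p ++ q = step r (p ++ q)

module _ {n s} {C : Structure n s} (coh : IsCoherent C) where
  open IsCoherent coh

  intersect-witness : ∀ {i j k u v u' v' x} → C i u v ≡ true → C i u' v' ≡ true →
                      C j u x ≡ true → C k x v ≡ true →
                      Σ (Fin n) λ x' → C j u' x' ≡ true × C k x' v' ≡ true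
  intersect-witness {i} {j} {k} {u} {v} {u'} {v'} iuv iu'v' jux kxv =
    let x' , jk = count≢0⇒true (λ x → C j u' x ∧ C k x v')
                    λ count≡0 → count-true≢0 (λ x → C j u x ∧ C k x v) (true-∧ jux kxv)
                                  (trans (intersect i j k u v u' v' iuv iu'v') count≡0)
    in x' , ∧-true jk

  -- The first edge (a, c) is copied to some (a', c') with (c, b) and (c', b') in a
  -- common basis relation, and the induction continues from there.
  Path-transport : ∀ R i {a b a' b'} → C i a b ≡ true → C i a' b' ≡ true →
                   Path (C R) a b → Path (C R) a' b'
  Path-transport R i iab ia'b' (edge Rab) with refl ← disjoint R i _ _ Rab iab = edge ia'b'
  Path-transport R i {b = b} iab ia'b' (step {w = c} Rac pcb) =
    let U , Ucb = cover c b
        c' , Ra'c' , Uc'b' = intersect-witness iab ia'b' Rac Ucb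
    in step Ra'c' (Path-transport R U Ucb Uc'b' pcb)

  Path-transport-converse : ∀ R i {a b a' b'} → C i a b ≡ true → C i a' b' ≡ true →
                            Path (C R) b a → Path (C R) b' a'
  Path-transport-converse R i iab ia'b' =
    let j , Cj≡Ciᵀ = converse i
    in Path-transport R j (trans (Cj≡Ciᵀ _ _) iab) (trans (Cj≡Ciᵀ _ _) ia'b')

insert : ∀ {n} → Fin n → VSet n → VSet n
insert y S u = does (u ≟ y) ∨ S u

∈-insert⁻ : ∀ {n} y (S : VSet n) u → insert y S u ≡ true → u ≡ y ⊎ S u ≡ true
∈-insert⁻ y S u u∈ with u ≟ y
... | yes u≡y = inj₁ u≡y
... | no  _   = inj₂ u∈

⊆-insert : ∀ {n} y (S : VSet n) → S ⊆ insert y S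
⊆-insert y S u Su rewrite Su = ∨-zeroʳ (does (u ≟ y))

y∈-insert : ∀ {n} y (S : VSet n) → insert y S y ≡ true
y∈-insert y S rewrite dec-true (y ≟ y) refl = refl

IsSCC-absorb : ∀ {n} {R : BinRel n} {W : VSet n} {w y} → IsSCC R W → W w ≡ true →
               Path R y w → Path R w y → W y ≡ true
IsSCC-absorb {R = R} {W} {w} {y} (W-sc , W-maximal) Ww pyw pwy =
  W-maximal (insert y W) (⊆-insert y W) insert-sc y (y∈-insert y W)
  where
  insert-sc : StronglyConnected R (insert y W)
  insert-sc u u' u∈ u'∈ with ∈-insert⁻ y W u u∈ | ∈-insert⁻ y W u' u'∈
  ... | inj₂ Wu   | inj₂ Wu'  = W-sc u u' Wu Wu'
  ... | inj₂ Wu   | inj₁ refl = W-sc u w Wu Ww ++ pwy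
  ... | inj₁ refl | inj₂ Wu'  = pyw ++ W-sc w u' Ww Wu'
  ... | inj₁ refl | inj₁ refl = pyw ++ pwy

true≢false : true ≢ false
true≢false ()

Refines-true : ∀ {n s k} {C : Structure n s} {A : Structure n k} → Refines C A →
               ∀ i e {u v u' v'} → C i u v ≡ true → A e u v ≡ true →
               C i u' v' ≡ true → A e u' v' ≡ true
Refines-true refines i e iuv euv iu'v' with refines i e
... | inj₁ i⊆e = i⊆e _ _ iu'v'
... | inj₂ i∩e≡∅ with () ← trans (sym (i∩e≡∅ _ _ iuv)) euv

lemma23 : ∀ {n k s : ℕ} (A : Structure n k) (C : Structure n s) →
              IsCoarsestCoherent A C →
              (R : Fin s) (E : Fin k) (V W : VSet n) →
              IsSCC (C R) V → IsSCC (C R) W →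
              (v' w' : Fin n) →
              Σ (Fin n) (λ v → V v ≡ true × A E v' v ≡ true) →
              (∀ w → W w ≡ true → A E w' w ≡ false) →
              (z : Fin n) → V z ≡ true →
              (T : Fin s) → C T v' z ≡ true →
              ∀ w → W w ≡ true → C T w' w ≡ false
lemma23 A C cc R E V W V-scc W-scc v' w' (v , Vv , Ev'v) w'-avoids-W z Vz T Tv'z w Ww =
  ¬-not ¬Tw'w
  where
  open IsCoarsestCoherent cc
  open IsCoherent coherent using (cover)
  ¬Tw'w : ¬ C T w' w ≡ true
  ¬Tw'w Tw'w =
    let U , Uv'v = cover v' v
        K , Kvz = cover v z
        y , Uw'y , Kyw = intersect-witness coherent Tv'z Tw'w Uv'v Kvz
        Wy = IsSCC-absorb W-scc Ww
               (Path-transport coherent R K Kvz Kyw (proj₁ V-scc v z Vv Vz))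
               (Path-transport-converse coherent R K Kvz Kyw (proj₁ V-scc z v Vz Vv))
        Ew'y = Refines-true refines U E Uv'v Ev'v Uw'y
    in true≢false (trans (sym Ew'y) (w'-avoids-W y Wy))
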